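{- For all $l$-terms $t_1,t_2$, if $t_1\to_s t_2$ then $|t_1|=_{\mathrm{CLC}}|t_2|$.
   Context: $i$-terms are ordinary terms built from variables and the constants $C,T,F,K,S$ by binary application (left-associated). $l$-terms: every $i$-term; the labelled constants $C_1,C_2,T_1,F_1,K_1$ and $S^{n_0,\ldots,n_k}$ ($k\ge1$, positive integers $n_i$); applications $(t_1t_2)$ of $l$-terms; tuples $\langle t_1,\ldots,t_n\rangle$ of $n\ge2$ $l$-terms; convention $\langle t\rangle\equiv t$. The leftmost erasure $|t|$ replaces $C_1,C_2$ by $C$, $T_1$ by $T$, $F_1$ by $F$, $K_1$ by $K$, $S^{\vec n}$ by $S$, and each tuple by (the erasure of) its first component. $\mathrm{CLC}$ is the conditional system on ordinary terms with rules $C\,T\,x\,y\to x$; $C\,F\,x\,y\to y$; $C\,z\,x\,y\to x \Leftarrow x=y$; $K\,x\,y\to x$; $S\,x\,y\,z\to x\,z\,(y\,z)$, with $=$ convertibility in $\mathrm{CLC}$ itself (defined by levels; level $0$ uses the empty relation, level $n+1$ the convertibility of level $n$); $=_{\mathrm{CLC}}$ denotes its convertibility. $\to_s$ is one-step contraction (in any context, including inside tuples) in the system $\mathrm{CLC}_s$ with rules $C_1T_1xy\to x$; $C_1F_1xy\to y$; $C_2zxy\to x\Leftarrow |x|=_{\mathrm{CLC}}|y|$; $C_2Txy\to x$; $C_2Fxy\to y$; $C_2T_1xy\to x$; $C_2F_1xy\to y$; $K_1xy\to x$; and $S^{n_0,\ldots,n_k}\,x\,\langle y_1,\ldots,y_k\rangle\,\langle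 z_{0,1},\ldots,z_{0,n_0},\ldots,z_{k,1},\ldots,z_{k,n_k}\rangle \to x\,\langle z_{0,1},\ldots,z_{0,n_0}\rangle\,\langle y_1\langle z_{1,1},\ldots,z_{1,n_1}\rangle,\ldots,y_k\langle z_{k,1},\ldots,z_{k,n_k}\rangle\rangle$ provided $|z_{i,j}|=_{\mathrm{CLC}}|z_{i',j'}|$ for all indices and $|y_i|=_{\mathrm{CLC}}|y_j|$ for all $i,j$. -}

module Defs where

open import Data.Nat using (ℕ; zero; suc; NonZero)
open import Data.Empty using (⊥)
open import Data.Product using (Σ; ∃; _×_; _,_; proj₁; proj₂)
open import Data.List using (List; []; _∷_)
open import Data.List.NonEmpty as L⁺ using (List⁺; _∷_; toList; _⁺++⁺_)
open import Data.List.Relation.Unary.All using (All)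
open import Data.List.Membership.Propositional using (_∈_)
open import Relation.Binary.Construct.Closure.Equivalence using (EqClosure)

data Term : Set where
  var : ℕ → Term
  C T F K S : Term
  _·_ : Term → Term → Term

infixl 9 _·_

data Red (R : Term → Term → Set) : Term → Term → Set where
  ruleCT : ∀ x y → Red R (C · T · x · y) x
  ruleCF : ∀ x y → Red R (C · F · x · y) y
  ruleCz : ∀ z x y → R x y → Red R (C · z · x · y) x
  ruleK  : ∀ x y → Red R (K · x · y) x
  ruleS  : ∀ x y z → Red R (S · x · y · z) (x · z · (y · z))
  appL   : ∀ {a b} c → Red R a b → Red R (a · c) (b · c)
  appR   : ∀ {a b} c → Red R a b → Red R (c · a) (c · b)

Lev : ℕ → Term → Term → Set
Lev zero    = EqClosure (Red (λ _ _ → ⊥))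
Lev (suc n) = EqClosure (Red (Lev n))

_=CLC_ : Term → Term → Set
a =CLC b = ∃ λ n → Lev n a b

infix 4 _=CLC_

-- l-terms.  A tuple ⟨t₁,…,tₙ⟩ (n ≥ 2) is  tup t₁ t₂ [t₃,…,tₙ].
-- The labelled constant S^{n₀,…,n_k} (k ≥ 1, all nᵢ positive) is
-- Sl n₀ (n₁ ∷ … ∷ n_k) p  with p a positivity proof.

data LTerm : Set where
  var : ℕ → LTerm
  C T F K S : LTerm
  C₁ C₂ T₁ F₁ K₁ : LTerm
  Sl  : (n₀ : ℕ) (ns : List⁺ ℕ) → All NonZero (n₀ ∷ toList ns) → LTerm
  _·_ : LTerm → LTerm → LTerm
  tup : LTerm → LTerm → List LTerm → LTerm

⟪_⟫ : List⁺ LTerm → LTerm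
⟪ t ∷ [] ⟫     = t
⟪ t ∷ u ∷ us ⟫ = tup t u us

∣_∣ : LTerm → Term
∣ var x ∣       = var x
∣ C ∣           = C
∣ T ∣           = T
∣ F ∣           = F
∣ K ∣           = K
∣ S ∣           = S
∣ C₁ ∣          = C
∣ C₂ ∣          = C
∣ T₁ ∣          = T
∣ F₁ ∣          = F
∣ K₁ ∣          = K
∣ Sl _ _ _ ∣    = S
∣ a · b ∣       = ∣ a ∣ · ∣ b ∣
∣ tup t _ _ ∣   = ∣ t ∣

-- In the S-rule, zs₀ is the block z_{0,1..n₀}, and bs lists the pairs
-- (yᵢ , block z_{i,1..nᵢ}) for i = 1..k (k ≥ 1, as bs is non-empty).

AllConv : List⁺ LTerm → Set
AllConv ts = ∀ a b → a ∈ toList ts → b ∈ toList ts → ∣ a ∣ =CLC ∣ b ∣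

mutual
  data _→s_ : LTerm → LTerm → Set where
    rC₁T : ∀ x y → C₁ · T₁ · x · y →s x
    rC₁F : ∀ x y → C₁ · F₁ · x · y →s y
    rC₂z : ∀ z x y → ∣ x ∣ =CLC ∣ y ∣ → C₂ · z · x · y →s x
    rC₂T : ∀ x y → C₂ · T · x · y →s x
    rC₂F : ∀ x y → C₂ · F · x · y →s y
    rC₂T₁ : ∀ x y → C₂ · T₁ · x · y →s x
    rC₂F₁ : ∀ x y → C₂ · F₁ · x · y →s y
    rK₁  : ∀ x y → K₁ · x · y →s x
    rS   : ∀ x (zs₀ : List⁺ LTerm) (bs : List⁺ (LTerm × List⁺ LTerm))
             (p : All NonZero (L⁺.length zs₀ ∷ toList (L⁺.map (λ b → L⁺.length (proj₂ b)) bs)))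
           → AllConv (zs₀ ⁺++⁺ L⁺.concat (L⁺.map proj₂ bs))
           → AllConv (L⁺.map proj₁ bs)
           → Sl (L⁺.length zs₀) (L⁺.map (λ b → L⁺.length (proj₂ b)) bs) p
               · x · ⟪ L⁺.map proj₁ bs ⟫ · ⟪ zs₀ ⁺++⁺ L⁺.concat (L⁺.map proj₂ bs) ⟫
             →s (x · ⟪ zs₀ ⟫ · ⟪ L⁺.map (λ b → proj₁ b · ⟪ proj₂ b ⟫) bs ⟫)
    appL : ∀ {a b} c → a →s b → (a · c) →s (b · c)
    appR : ∀ {a b} c → a →s b → (c · a) →s (c · b)
    tup₁ : ∀ {a b} u us → a →s b → tup a u us →s tup b u us
    tup₂ : ∀ {a b} t us → a →s b → tup t a us →s tup t b us
    tupL : ∀ {as bs} t u → as →sL bs → tup t u as →s tup t u bs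

  data _→sL_ : List LTerm → List LTerm → Set where
    here  : ∀ {a b} us → a →s b → (a ∷ us) →sL (b ∷ us)
    there : ∀ {as bs} u → as →sL bs → (u ∷ as) →sL (u ∷ bs)

infix 4 _→s_ _→sL_

-- Erasure sends every labelled redex to a CLC redex: the C₁, C₂ and K₁ rules erase to the
-- rules for C and K, and the side condition ∣x∣ = ∣y∣ of C₂ z x y → x, holding at some
-- level n, licenses the conditional C-step at level n + 1.  A tuple erases to its first
-- component, so the S-rule erases to S x y₁ z₀₁ → x z₀₁ (y₁ z₁₁), which is an S-step
-- followed by the conversion z₀₁ = z₁₁ demanded by the rule; a contraction inside any
-- other tuple component is invisible after erasure.  Contexts are handled because each
-- level of convertibility is a congruence, and levels are cumulative, so conversions at
-- different levels compose.
module Submission where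

open import Defs
open import Data.Nat using (zero; suc; _⊔_; _≤_; z≤n; s≤s)
open import Data.Nat.Properties using (m≤m⊔n; m≤n⊔m)
open import Data.Empty using (⊥)
open import Data.Product using (_×_; _,_; proj₁; proj₂)
open import Data.List using ([]; _∷_)
open import Data.List.NonEmpty as L⁺ using (List⁺; _∷_; _⁺++⁺_)
open import Data.List.Relation.Unary.Any using (here; there)
open import Data.List.Membership.Propositional.Properties using (∈-++⁺ʳ)
open import Relation.Binary.PropositionalEquality using (_≡_; refl)
open import Relation.Binary.Construct.Closure.Equivalence as EqClosure
open import Relation.Binary.Construct.Closure.ReflexiveTransitive using (ε; _◅◅_)

Red-mono : ∀ {R R′ : Term → Term → Set} → (∀ {a b} → R a b → R′ a b) →
           ∀ {a b} → Red R a b → Red R′ a b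
Red-mono f (ruleCT x y)     = ruleCT x y
Red-mono f (ruleCF x y)     = ruleCF x y
Red-mono f (ruleCz z x y r) = ruleCz z x y (f r)
Red-mono f (ruleK x y)      = ruleK x y
Red-mono f (ruleS x y z)    = ruleS x y z
Red-mono f (appL c r)       = appL c (Red-mono f r)
Red-mono f (appR c r)       = appR c (Red-mono f r)

Lev-suc : ∀ n {a b} → Lev n a b → Lev (suc n) a b
Lev-suc zero    = EqClosure.map (Red-mono λ ())
Lev-suc (suc n) = EqClosure.map (Red-mono (Lev-suc n))

Lev-mono : ∀ {m n} → m ≤ n → ∀ {a b} → Lev m a b → Lev n a b
Lev-mono {zero}  {zero}  _         = λ p → p
Lev-mono {zero}  {suc n} _         = λ p → Lev-suc n (Lev-mono {zero} {n} z≤n p)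
Lev-mono {suc m} {suc n} (s≤s m≤n) = EqClosure.map (Red-mono (Lev-mono m≤n))

Lev-trans : ∀ n {a b c} → Lev n a b → Lev n b c → Lev n a c
Lev-trans zero    = _◅◅_
Lev-trans (suc n) = _◅◅_

Lev-cong : ∀ n (f : Term → Term) → (∀ {R a b} → Red R a b → Red R (f a) (f b)) →
           ∀ {a b} → Lev n a b → Lev n (f a) (f b)
Lev-cong zero    f f-red = EqClosure.gmap f f-red
Lev-cong (suc n) f f-red = EqClosure.gmap f f-red

=CLC-refl : ∀ {a} → a =CLC a
=CLC-refl = 0 , ε

=CLC-trans : ∀ {a b c} → a =CLC b → b =CLC c → a =CLC c
=CLC-trans (m , p) (n , q) =
  m ⊔ n , Lev-trans (m ⊔ n) (Lev-mono (m≤m⊔n m n) p) (Lev-mono (m≤n⊔m m n) q)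

·-congˡ : ∀ c {a b} → a =CLC b → a · c =CLC b · c
·-congˡ c (n , p) = n , Lev-cong n (_· c) (appL c) p

·-congʳ : ∀ c {a b} → a =CLC b → c · a =CLC c · b
·-congʳ c (n , p) = n , Lev-cong n (c ·_) (appR c) p

Red⊥⇒=CLC : ∀ {a b} → Red (λ _ _ → ⊥) a b → a =CLC b
Red⊥⇒=CLC r = 0 , EqClosure.return r

Red-Lev⇒=CLC : ∀ {n a b} → Red (Lev n) a b → a =CLC b
Red-Lev⇒=CLC {n} r = suc n , EqClosure.return r

S-step-conv : ∀ {x y z z′} → z =CLC z′ → S · x · y · z =CLC x · z · (y · z′)
S-step-conv {x} {y} {z} z=z′ =
  =CLC-trans (Red⊥⇒=CLC (ruleS x y z)) (·-congʳ (x · z) (·-congʳ y z=z′))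

∣⟪⟫∣≡∣head∣ : ∀ (ts : List⁺ LTerm) → ∣ ⟪ ts ⟫ ∣ ≡ ∣ L⁺.head ts ∣
∣⟪⟫∣≡∣head∣ (t ∷ [])     = refl
∣⟪⟫∣≡∣head∣ (t ∷ u ∷ us) = refl

rS-sound : ∀ x (zs₀ : List⁺ LTerm) (bs : List⁺ (LTerm × List⁺ LTerm)) →
           AllConv (zs₀ ⁺++⁺ L⁺.concat (L⁺.map proj₂ bs)) →
           S · ∣ x ∣ · ∣ ⟪ L⁺.map proj₁ bs ⟫ ∣ · ∣ ⟪ zs₀ ⁺++⁺ L⁺.concat (L⁺.map proj₂ bs) ⟫ ∣
             =CLC ∣ x ∣ · ∣ ⟪ zs₀ ⟫ ∣ · ∣ ⟪ L⁺.map (λ b → proj₁ b · ⟪ proj₂ b ⟫) bs ⟫ ∣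
rS-sound x zs₀@(z₀ ∷ zs) bs@((y₁ , zs₁@(z₁ ∷ _)) ∷ _) zs-conv
  rewrite ∣⟪⟫∣≡∣head∣ (L⁺.map proj₁ bs)
        | ∣⟪⟫∣≡∣head∣ (zs₀ ⁺++⁺ L⁺.concat (L⁺.map proj₂ bs))
        | ∣⟪⟫∣≡∣head∣ zs₀
        | ∣⟪⟫∣≡∣head∣ (L⁺.map (λ b → proj₁ b · ⟪ proj₂ b ⟫) bs)
        | ∣⟪⟫∣≡∣head∣ zs₁
  = S-step-conv (zs-conv z₀ z₁ (here refl) (there (∈-++⁺ʳ zs (here refl))))

mainTheorem9 : ∀ (t₁ t₂ : LTerm) → t₁ →s t₂ → ∣ t₁ ∣ =CLC ∣ t₂ ∣
mainTheorem9 _ _ (rC₁T x y)                 = Red⊥⇒=CLC (ruleCT _ _)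
mainTheorem9 _ _ (rC₁F x y)                 = Red⊥⇒=CLC (ruleCF _ _)
mainTheorem9 _ _ (rC₂z z x y (_ , x=y))     = Red-Lev⇒=CLC (ruleCz _ _ _ x=y)
mainTheorem9 _ _ (rC₂T x y)                 = Red⊥⇒=CLC (ruleCT _ _)
mainTheorem9 _ _ (rC₂F x y)                 = Red⊥⇒=CLC (ruleCF _ _)
mainTheorem9 _ _ (rC₂T₁ x y)                = Red⊥⇒=CLC (ruleCT _ _)
mainTheorem9 _ _ (rC₂F₁ x y)                = Red⊥⇒=CLC (ruleCF _ _)
mainTheorem9 _ _ (rK₁ x y)                  = Red⊥⇒=CLC (ruleK _ _)
mainTheorem9 _ _ (rS x zs₀ bs _ zs-conv _)  = rS-sound x zs₀ bs zs-conv
mainTheorem9 _ _ (appL c r)                 = ·-congˡ ∣ c ∣ (mainTheorem9 _ _ r)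
mainTheorem9 _ _ (appR c r)                 = ·-congʳ ∣ c ∣ (mainTheorem9 _ _ r)
mainTheorem9 _ _ (tup₁ u us r)              = mainTheorem9 _ _ r
mainTheorem9 _ _ (tup₂ t us r)              = =CLC-refl
mainTheorem9 _ _ (tupL t u r)               = =CLC-refl
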